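{- Let $(V,E,F,H)$ be an instance of Constrained Correlation Clustering admitting a valid clustering, and let $G'=\textsc{Transform}(G,F,H)$. For every $uv\in H$, the nodes $u$ and $v$ are not adjacent in $G'$ and have no common neighbor in $G'$.
   Context: Instance: graph $G=(V,E)$, friendly pairs $F$, hostile pairs $H\subseteq\binom V2$; a clustering (partition of $V$) is valid if no pair of $F$ is split and no pair of $H$ lies in one cluster. Supernodes are connected components of $(V,F)$; $s(u)$ is the supernode of $u$; supernodes $U,W$ are hostile if some $uw\in H$ has $u\in U,w\in W$. $\textsc{Transform}(G,F,H)$: if some supernode is hostile to itself return $(\emptyset,\emptyset)$; otherwise $E_1=E\cup\{uv:s(u)=s(v)\}$, $E_2=E_1\setminus\{uv:s(u),s(v)\text{ hostile}\}$, $E_3$ obtained from $E_2$ by repeatedly, while there exist distinct supernodes $U_1,U_2,U_3$ with $U_1,U_2$ hostile and $u_1\in U_1,u_2\in U_2,u_3,u_3'\in U_3$ with $u_1u_3,u_2u_3'\in E_3$, removing these two edges, and $E_4$ obtained from $E_3$ by, for each pair of distinct supernodes $U_1,U_2$, adding all pairs between them if more than $\frac{3-\sqrt5}2|U_1||U_2|$ of them are edges and removing all of them otherwise; return $(V,E_4)$. -}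

module Defs where

open import Data.Nat using (ℕ; _+_; _*_; _∸_; _^_; _≤_; _<_)
open import Data.Fin using (Fin)
open import Data.Product using (Σ; ∃; ∃-syntax; _×_; _,_)
open import Data.Sum using (_⊎_)
open import Data.List using (List; length)
open import Data.List.Membership.Propositional using (_∈_)
open import Data.List.Relation.Unary.Unique.Propositional using (Unique)
open import Relation.Nullary using (¬_)
open import Relation.Binary.PropositionalEquality using (_≡_; _≢_)
open import Relation.Binary.Construct.Closure.ReflexiveTransitive using (Star)
open import Function.Bundles using (_⇔_)

-- A (binary) relation on the vertex set Fin n; an edge set / set of pairs
-- is represented by a symmetric relation (the unordered pair uv is in the
-- set iff  R u v  holds).
PairSet : ℕ → Set₁
PairSet n = Fin n → Fin n → Set

Symmetric : ∀ {n} → PairSet n → Set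
Symmetric R = ∀ u v → R u v → R v u

Irreflexive : ∀ {n} → PairSet n → Set
Irreflexive R = ∀ u → ¬ R u u

-- A clustering (partition of V) given by a cluster label for each node.
-- It is valid if no friendly pair is split and no hostile pair lies in one cluster.
ValidClustering : ∀ {n} → PairSet n → PairSet n → (Fin n → ℕ) → Set
ValidClustering F H c =
  (∀ u v → F u v → c u ≡ c v) × (∀ u v → H u v → c u ≢ c v)

-- s(u) = s(v): u and v lie in the same connected component of (V,F).
SameSN : ∀ {n} → PairSet n → PairSet n
SameSN F = Star F

HostileSN : ∀ {n} → PairSet n → PairSet n → PairSet n
HostileSN F H u v = ∃[ x ] ∃[ y ] (SameSN F u x × SameSN F v y × H x y)

SelfHostile : ∀ {n} → PairSet n → PairSet n → Set
SelfHostile F H = ∃[ u ] HostileSN F H u u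

E₁ : ∀ {n} → PairSet n → PairSet n → PairSet n
E₁ E F u v = E u v ⊎ (u ≢ v × SameSN F u v)

E₂ : ∀ {n} → PairSet n → PairSet n → PairSet n → PairSet n
E₂ E F H u v = E₁ E F u v × ¬ HostileSN F H u v

SamePair : ∀ {n} → Fin n → Fin n → Fin n → Fin n → Set
SamePair x y a b = (x ≡ a × y ≡ b) ⊎ (x ≡ b × y ≡ a)

-- the side condition of the removal loop, for a concrete choice of
-- u₁ ∈ U₁, u₂ ∈ U₂, u₃, u₃' ∈ U₃
RemovalApplies : ∀ {n} → PairSet n → PairSet n → PairSet n →
                 Fin n → Fin n → Fin n → Fin n → Set
RemovalApplies F H R u₁ u₂ u₃ u₃' =
  ¬ SameSN F u₁ u₂ × ¬ SameSN F u₁ u₃ × ¬ SameSN F u₂ u₃ ×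
  HostileSN F H u₁ u₂ × SameSN F u₃ u₃' × R u₁ u₃ × R u₂ u₃'

RemovalPossible : ∀ {n} → PairSet n → PairSet n → PairSet n → Set
RemovalPossible F H R =
  ∃[ u₁ ] ∃[ u₂ ] ∃[ u₃ ] ∃[ u₃' ] RemovalApplies F H R u₁ u₂ u₃ u₃'

RemovalStep : ∀ {n} → PairSet n → PairSet n → PairSet n → PairSet n → Set
RemovalStep F H R R' =
  ∃[ u₁ ] ∃[ u₂ ] ∃[ u₃ ] ∃[ u₃' ]
    (RemovalApplies F H R u₁ u₂ u₃ u₃' ×
     (∀ x y → R' x y ⇔ (R x y × ¬ SamePair x y u₁ u₃ × ¬ SamePair x y u₂ u₃')))

-- E₃ is a possible outcome of the (nondeterministic) removal loop started at E₂
IsE₃ : ∀ {n} → PairSet n → PairSet n → PairSet n → PairSet n → Set₁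
IsE₃ E F H R =
  Star (RemovalStep F H) (E₂ E F H) R × ¬ RemovalPossible F H R

Card : {A : Set} → (A → Set) → ℕ → Set
Card {A} P k = Σ (List A) λ xs → Unique xs × length xs ≡ k × (∀ a → P a ⇔ (a ∈ xs))

-- m > ((3 - √5)/2) * k, written in exact natural-number arithmetic:
-- equivalent to  √5 k > 3k - 2m.
Exceeds : ℕ → ℕ → Set
Exceeds m k = (3 * k < 2 * m) ⊎ (2 * m ≤ 3 * k × (3 * k ∸ 2 * m) ^ 2 < 5 * k ^ 2)

-- pairs between s(u) and s(v) (as ordered pairs (x,y), x ∈ s(u), y ∈ s(v);
-- for distinct supernodes these correspond bijectively to unordered pairs)
Between : ∀ {n} → PairSet n → Fin n → Fin n → Fin n × Fin n → Set
Between F u v (x , y) = SameSN F u x × SameSN F v y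

BetweenEdges : ∀ {n} → PairSet n → PairSet n → Fin n → Fin n → Fin n × Fin n → Set
BetweenEdges F R u v (x , y) = Between F u v (x , y) × R x y

E₄ : ∀ {n} → PairSet n → PairSet n → PairSet n
E₄ F R u v =
  (SameSN F u v × R u v) ⊎
  (¬ SameSN F u v × ∃[ k ] ∃[ m ]
     (Card (Between F u v) k × Card (BetweenEdges F R u v) m × Exceeds m k))

-- G' is an output of Transform(G,F,H) (with vertex set kept as Fin n;
-- in the degenerate case the output graph has no edges).
IsTransform : ∀ {n} → PairSet n → PairSet n → PairSet n → PairSet n → Set₁
IsTransform E F H G' =
  (SelfHostile F H → ∀ u v → ¬ G' u v) ×
  (¬ SelfHostile F H →
     Σ (PairSet _) λ R → IsE₃ E F H R × (∀ u v → G' u v ⇔ E₄ F R u v))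

-- Every edge of E₄ between two supernodes is backed by an edge of E₃ between
-- them, and E₃ ⊆ E₂ contains no edge between hostile supernodes; so a hostile
-- pair u v is not adjacent. A common neighbour w would give E₃-edges from s(u)
-- to s(w) and from s(w) to s(v), with s(u), s(w), s(v) distinct (otherwise one
-- of these edges joins hostile supernodes, or s(u) is self-hostile) — exactly
-- the configuration the removal loop eliminates before it stops.
module Submission where

open import Defs
open import Data.Nat using (ℕ; zero; suc; _+_; _*_; _^_; _≤_; _<_; z≤n; s≤s)
open import Data.Nat.Properties using (≤⇒≯; m≤m+n)
open import Data.Nat.Solver using (module +-*-Solver)
open import Data.Fin using (Fin)
open import Data.Product using (∃; ∃-syntax; _×_; _,_; proj₁; proj₂)
open import Data.Sum using (inj₁; inj₂)
open import Data.List using ([]; _∷_)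
open import Data.List.Relation.Unary.Any using (here)
open import Data.Empty using (⊥-elim)
open import Relation.Nullary using (¬_)
open import Relation.Binary.PropositionalEquality using (_≡_; refl; sym; subst)
open import Relation.Binary.Construct.Closure.ReflexiveTransitive using (Star; ε; _◅_; _◅◅_; reverse)
open import Function.Bundles using (Equivalence)

open Equivalence using (to; from)

nine≡five+four : ∀ k → (3 * k) ^ 2 ≡ 5 * k ^ 2 + 4 * k ^ 2
nine≡five+four = solve 1 (λ k → (con 3 :* k) :^ 2 := con 5 :* k :^ 2 :+ con 4 :* k :^ 2) refl
  where open +-*-Solver

Exceeds⇒positive : ∀ {m k} → Exceeds m k → 0 < m
Exceeds⇒positive {suc m} _ = s≤s z≤n
Exceeds⇒positive {zero} (inj₁ ())
Exceeds⇒positive {zero} {k} (inj₂ (_ , 9k²<5k²)) =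
  ⊥-elim (≤⇒≯ (subst (5 * k ^ 2 ≤_) (sym (nine≡five+four k)) (m≤m+n _ _)) 9k²<5k²)

Card⇒inhabited : ∀ {A : Set} {P : A → Set} {m} → Card P m → 0 < m → ∃ P
Card⇒inhabited ([] , _ , refl , _) ()
Card⇒inhabited (a ∷ _ , _ , _ , P⇔∈) _ = a , from (P⇔∈ a) (here refl)

_⊆_ : ∀ {n} → PairSet n → PairSet n → Set
R ⊆ S = ∀ x y → R x y → S x y

module Supernodes {n : ℕ} (F H : PairSet n) (sym-F : Symmetric F) (sym-H : Symmetric H) where

  SameSN-sym : ∀ {a b} → SameSN F a b → SameSN F b a
  SameSN-sym = reverse (λ {x} {y} → sym-F x y)

  HostileSN-resp : ∀ {u v u' v'} → HostileSN F H u v →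
                   SameSN F u u' → SameSN F v v' → HostileSN F H u' v'
  HostileSN-resp (x , y , ux , vy , h) uu' vv' =
    x , y , SameSN-sym uu' ◅◅ ux , SameSN-sym vv' ◅◅ vy , h

  HostileSN-sym : ∀ {u v} → HostileSN F H u v → HostileSN F H v u
  HostileSN-sym (x , y , ux , vy , h) = y , x , vy , ux , sym-H x y h

  EdgeBetween : PairSet n → PairSet n
  EdgeBetween R u v = ∃[ x ] ∃[ y ] (SameSN F u x × SameSN F v y × R x y)

  NoHostileEdges : PairSet n → Set
  NoHostileEdges R = ∀ x y → R x y → ¬ HostileSN F H x y

  E₄⇒EdgeBetween : ∀ {R u v} → E₄ F R u v → EdgeBetween R u v
  E₄⇒EdgeBetween {u = u} {v} (inj₁ (_ , r)) = u , v , ε , ε , r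
  E₄⇒EdgeBetween (inj₂ (_ , k , m , _ , card , exceeds))
    with Card⇒inhabited card (Exceeds⇒positive {m} {k} exceeds)
  ... | (x , y) , (ux , vy) , r = x , y , ux , vy , r

  no-EdgeBetween-hostile : ∀ {R u v} → NoHostileEdges R →
                           HostileSN F H u v → ¬ EdgeBetween R u v
  no-EdgeBetween-hostile noHostile h (x , y , ux , vy , r) =
    noHostile x y r (HostileSN-resp h ux vy)

  E₂-symmetric : ∀ E → Symmetric E → Symmetric (E₂ E F H)
  E₂-symmetric E sym-E u v (inj₁ e , ¬h) = inj₁ (sym-E u v e) , λ h → ¬h (HostileSN-sym h)
  E₂-symmetric E sym-E u v (inj₂ (u≢v , s) , ¬h) =
    inj₂ ((λ v≡u → u≢v (sym v≡u)) , SameSN-sym s) , λ h → ¬h (HostileSN-sym h)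

  SamePair-swap : ∀ {x y a b : Fin n} → SamePair y x a b → SamePair x y a b
  SamePair-swap (inj₁ (p , q)) = inj₂ (q , p)
  SamePair-swap (inj₂ (p , q)) = inj₁ (q , p)

  RemovalStep-⊆ : ∀ {R R'} → RemovalStep F H R R' → R' ⊆ R
  RemovalStep-⊆ (_ , _ , _ , _ , _ , R'⇔) x y r' = proj₁ (to (R'⇔ x y) r')

  RemovalStep-symmetric : ∀ {R R'} → RemovalStep F H R R' → Symmetric R → Symmetric R'
  RemovalStep-symmetric (_ , _ , _ , _ , _ , R'⇔) sym-R x y r' with to (R'⇔ x y) r'
  ... | r , ¬p₁ , ¬p₂ =
    from (R'⇔ y x) (sym-R x y r , (λ p → ¬p₁ (SamePair-swap p)) , (λ p → ¬p₂ (SamePair-swap p)))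

  Removals-⊆ : ∀ {R R'} → Star (RemovalStep F H) R R' → R' ⊆ R
  Removals-⊆ ε x y r = r
  Removals-⊆ (step ◅ steps) x y r = RemovalStep-⊆ step x y (Removals-⊆ steps x y r)

  Removals-symmetric : ∀ {R R'} → Star (RemovalStep F H) R R' → Symmetric R → Symmetric R'
  Removals-symmetric ε sym-R = sym-R
  Removals-symmetric (step ◅ steps) sym-R =
    Removals-symmetric steps (RemovalStep-symmetric step sym-R)

  E₃-symmetric : ∀ {E R} → Symmetric E → IsE₃ E F H R → Symmetric R
  E₃-symmetric {E} sym-E (steps , _) = Removals-symmetric steps (E₂-symmetric E sym-E)

  E₃-NoHostileEdges : ∀ {E R} → IsE₃ E F H R → NoHostileEdges R
  E₃-NoHostileEdges (steps , _) x y r = proj₂ (Removals-⊆ steps x y r)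

  hostile-common-neighbour⇒RemovalPossible :
    ∀ {R u v w} → ¬ SelfHostile F H → Symmetric R → NoHostileEdges R →
    HostileSN F H u v → EdgeBetween R u w → EdgeBetween R w v → RemovalPossible F H R
  hostile-common-neighbour⇒RemovalPossible {u = u} ¬self sym-R noHostile h
    uw@(x , y , ux , wy , r) wv@(x' , y' , wx' , vy' , r') =
    x , y' , y , x' ,
    (λ xy' → ¬self (u , HostileSN-resp h ε (SameSN-sym (ux ◅◅ xy' ◅◅ SameSN-sym vy')))) ,
    (λ xy → no-EdgeBetween-hostile noHostile (HostileSN-resp h (ux ◅◅ xy ◅◅ SameSN-sym wy) ε) wv) ,
    (λ y'y → no-EdgeBetween-hostile noHostile (HostileSN-resp h ε (vy' ◅◅ y'y ◅◅ SameSN-sym wy)) uw) ,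
    HostileSN-resp h ux vy' ,
    SameSN-sym wy ◅◅ wx' ,
    r , sym-R x' y' r'

lemma25 : (n : ℕ) (E F H : PairSet n) →
    Symmetric E → Irreflexive E → Symmetric F → Symmetric H → Irreflexive H →
    (∃[ c ] ValidClustering F H c) →
    (G' : PairSet n) → IsTransform E F H G' →
    ∀ u v → H u v → ¬ G' u v × ¬ (∃[ w ] (G' u w × G' w v))
lemma25 n E F H sym-E _ sym-F sym-H _ _ G' (degenerate , regular) u v huv =
  not-adjacent , no-common-neighbour
  where
    open Supernodes F H sym-F sym-H

    hostile : HostileSN F H u v
    hostile = u , v , ε , ε , huv

    -- This replaces the valid-clustering hypothesis: an edge of G' rules out
    -- the degenerate branch of Transform, whose output has no edges.
    consistent : ∀ {a b} → G' a b → ¬ SelfHostile F H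
    consistent {a} {b} g self = degenerate self a b g

    not-adjacent : ¬ G' u v
    not-adjacent g with regular (consistent g)
    ... | _ , e₃ , G'⇔E₄ =
      no-EdgeBetween-hostile (E₃-NoHostileEdges e₃) hostile (E₄⇒EdgeBetween (to (G'⇔E₄ u v) g))

    no-common-neighbour : ¬ (∃[ w ] (G' u w × G' w v))
    no-common-neighbour (w , g₁ , g₂) with regular (consistent g₁)
    ... | _ , e₃ , G'⇔E₄ =
      proj₂ e₃ (hostile-common-neighbour⇒RemovalPossible (consistent g₁) (E₃-symmetric sym-E e₃)
        (E₃-NoHostileEdges e₃) hostile
        (E₄⇒EdgeBetween (to (G'⇔E₄ u w) g₁)) (E₄⇒EdgeBetween (to (G'⇔E₄ w v) g₂)))
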